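{- There is a constant $C$ such that for every trie $T$ with $n$ edges, $\sum_{r} e_r \le C\,n$, where the sum ranges over all runs $r$ of $T$ and $e_r$ denotes the exponent of $r$.
   Context: A trie is a rooted tree whose edges are labeled by symbols of an alphabet $\Sigma$, such that the edges from any node to its children carry pairwise distinct labels. For nodes $u,v$ with $v$ an ancestor of $u$, $\mathit{str}(u,v)$ is the concatenation of the edge labels along the path from $u$ up to $v$. For a nonempty string $w$, an integer $1\le p\le |w|$ is a period of $w$ if $w[i]=w[i+p]$ for all $1\le i\le |w|-p$; $\pi(w)$ is the smallest period. A run is a pair $(v_i,v_j)$ of nodes with $v_j$ a proper ancestor of $v_i$ such that $\pi(\mathit{str}(v_i,v_j)) \le |\mathit{str}(v_i,v_j)|/2$, and for every descendant $v_{i'}$ of $v_i$ (including $v_i$) and every ancestor $v_{j'}$ of $v_j$ (including $v_j$) with $(v_{i'},v_{j'})\neq(v_i,v_j)$, $\pi(\mathit{str}(v_{i'},v_{j'}))\neq \pi(\mathit{str}(v_i,v_j))$. The period of a run $r=(v_i,v_j)$ is $p=\pi(\mathit{str}(v_i,v_j))$ and its exponent is $e_r=|\mathit{str}(v_i,v_j)|/p$. -}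

module Defs where

open import Data.Nat as ℕ using (ℕ; zero; suc; _+_; _*_; _≤_; _<_)
open import Data.Fin using (Fin; zero; suc; toℕ)
open import Data.List using (List; []; _∷_; _++_; length; lookup; map; foldr)
open import Data.List.Relation.Unary.Unique.Propositional using (Unique)
open import Data.Product using (_×_; _,_; Σ; ∃-syntax)
open import Data.Integer using (+_)
open import Data.Rational as ℚ using (ℚ; 0ℚ)
open import Relation.Binary.PropositionalEquality using (_≡_; _≢_)
open import Relation.Nullary using (¬_)

-- Nodes are Fin (suc n); node 0 is the
-- root and node (suc i) is the child of node (parent i) via an edge labelled
-- (label i).  Parents have smaller index (topological numbering), so every
-- rooted tree with n edges is representable.
record Trie (A : Set) (n : ℕ) : Set where
  field
    parent    : (i : Fin n) → Fin (suc (toℕ i))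
    label     : Fin n → A
    distinct  : (i j : Fin n) → toℕ (parent i) ≡ toℕ (parent j) →
                label i ≡ label j → i ≡ j
open Trie public

parentNode : ∀ {A n} → Trie A n → Fin n → Fin (suc n)
parentNode {n = n} T i = Data.Fin.inject≤ (parent T i) (Data.Nat.Properties.m≤n⇒m≤1+n (Data.Fin.Properties.toℕ<n i))
  where import Data.Fin ; import Data.Fin.Properties ; import Data.Nat.Properties

-- Str T u v w : v is an ancestor of u (or u itself) and w = str(u,v), the
-- concatenation of the labels on the path going up from u to v.
data Str {A : Set} {n : ℕ} (T : Trie A n) : Fin (suc n) → Fin (suc n) → List A → Set where
  here : ∀ u → Str T u u []
  up   : ∀ (i : Fin n) {v w} → Str T (parentNode T i) v w →
         Str T (suc i) v (label T i ∷ w)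

IsPeriod : {A : Set} → List A → ℕ → Set
IsPeriod w p = 1 ≤ p × p ≤ length w ×
  ((i j : Fin (length w)) → toℕ j ≡ toℕ i + p → lookup w i ≡ lookup w j)

IsSmallestPeriod : {A : Set} → List A → ℕ → Set
IsSmallestPeriod w p = IsPeriod w p × ((q : ℕ) → IsPeriod w q → p ≤ q)

record Run {A : Set} {n : ℕ} (T : Trie A n) : Set where
  field
    lower upper : Fin (suc n)
    str         : List A
    period      : ℕ
    path        : Str T lower upper str
    proper      : 1 ≤ length str            -- upper is a proper ancestor
    smallest    : IsSmallestPeriod str period
    squared     : 2 * period ≤ length str
    maximal     : ∀ u' v' x y → Str T u' lower x → Str T upper v' y →
                  (u' , v') ≢ (lower , upper) →
                  ∀ w' → Str T u' v' w' → ¬ IsSmallestPeriod w' period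
open Run public

endpoints : ∀ {A n} {T : Trie A n} → Run T → Fin (suc n) × Fin (suc n)
endpoints r = lower r , upper r

exponent : ∀ {A n} {T : Trie A n} → Run T → ℚ
exponent r with period r | smallest r
... | suc p | _ = (+ length (str r)) ℚ./ suc p
... | zero  | _ = 0ℚ   -- impossible: periods are ≥ 1

sumExponents : ∀ {A n} {T : Trie A n} → List (Run T) → ℚ
sumExponents rs = foldr (λ r s → exponent r ℚ.+ s) 0ℚ rs

-- Read a run r of period p and length ℓ as the p-periodic word of label codes from its lower
-- end upwards. The letter just above the run is smaller than the one p below it in one of
-- the two orders of the alphabet, the orientation of r. In that order the least rotation of
-- a period is a Lyndon word, and its occurrences j + t p inside r number at least e_r / 3.
-- The node where such a Lyndon root starts, together with the orientation, determines the
-- run: a Lyndon word cannot extend a periodic stretch followed by a smaller letter, which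
-- forces equal periods; the tops then agree by right maximality, and the bottoms by left
-- maximality and the distinctness of sibling labels. So the roots of distinct runs are
-- distinct among 2n (edge, orientation) pairs, and the exponents sum to at most 6n.
module Submission where

open import Defs
open import Data.Bool using (Bool; true; false)
open import Data.Empty using (⊥; ⊥-elim)
open import Data.Fin as Fin using (Fin; zero; suc; toℕ)
open import Data.Fin.Properties
  using (toℕ<n; toℕ-inject≤; toℕ-fromℕ<; toℕ-injective; injective⇒≤; ↑ˡ-injective; ↑ʳ-injective; splitAt-↑ˡ; splitAt-↑ʳ)
import Data.Integer as ℤ
import Data.Integer.Properties as ℤP
open import Data.List using (List; []; _∷_; length; lookup; map; concat; tabulate)
open import Data.List.Membership.Propositional.Properties using (∈-lookup; ∈-tabulate⁻)
open import Data.List.Properties using (length-++; length-tabulate)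
open import Data.List.Relation.Binary.Disjoint.Propositional using (Disjoint)
import Data.List.Relation.Unary.All as All
import Data.List.Relation.Unary.All.Properties as AllP
open import Data.List.Relation.Unary.AllPairs as AllPairs using (_∷_)
import Data.List.Relation.Unary.AllPairs.Properties as AllPairsP
open import Data.List.Relation.Unary.Unique.Propositional using (Unique)
open import Data.List.Relation.Unary.Unique.Propositional.Properties using (tabulate⁺; concat⁺)
import Data.Rational as ℚ
import Data.Rational.Properties as ℚP
open import Data.Rational.Unnormalised using (mkℚᵘ; *≤*; *≡*)
import Data.Rational.Unnormalised.Properties as ℚᵘP
open import Data.Nat
open import Data.Nat.DivMod
open import Data.Nat.ListAction using (sum)
open import Data.Nat.Properties
open import Data.Nat.Solver using (module +-*-Solver)
open import Data.Product using (∃-syntax; _×_; _,_; proj₁; proj₂)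
open import Data.Sum using (_⊎_; inj₁; inj₂)
open import Function using (_∘_; case_of_)
open import Function.Definitions using (Injective)
open import Function.Bundles using (_⇔_; mk⇔; module Equivalence)
open import Relation.Binary.Definitions using (Trichotomous; tri<; tri≈; tri>)
open import Relation.Binary.PropositionalEquality
open import Relation.Nullary using (¬_; Dec; yes; no)
open import Relation.Nullary.Decidable using (¬¬-excluded-middle; decidable-stable)

open +-*-Solver

-- Periodic words and Lyndon words

Word : Set
Word = ℕ → ℕ

shift : Word → ℕ → Word
shift X j i = X (j + i)

Periodic : Word → ℕ → ℕ → Set
Periodic X q k = ∀ i → i + q < k → X i ≡ X (i + q)

Periodic∞ : Word → ℕ → Set
Periodic∞ X q = ∀ i → X (i + q) ≡ X i

Periodic-* : ∀ {X q k} → Periodic X q k → ∀ a t → a + t * q < k → X (a + t * q) ≡ X a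
Periodic-* {X} {q} per a zero    _ = cong X (+-identityʳ a)
Periodic-* {X} {q} {k} per a (suc t) lt = begin
  X (a + (q + t * q))  ≡⟨ cong X a+[q+tq]≡a+tq+q ⟩
  X (a + t * q + q)    ≡⟨ per (a + t * q) (subst (_< k) a+[q+tq]≡a+tq+q lt) ⟨
  X (a + t * q)        ≡⟨ Periodic-* per a t (≤-<-trans (+-monoʳ-≤ a (m≤n+m (t * q) q)) lt) ⟩
  X a                  ∎
  where
    open ≡-Reasoning
    a+[q+tq]≡a+tq+q : a + (q + t * q) ≡ a + t * q + q
    a+[q+tq]≡a+tq+q = solve 3 (λ a q tq → a :+ (q :+ tq) := a :+ tq :+ q) refl a q (t * q)

Periodic∞-* : ∀ {X p} → Periodic∞ X p → ∀ a t → X (a + t * p) ≡ X a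
Periodic∞-* per a t = Periodic-* (λ i _ → sym (per i)) a t ≤-refl

Periodic-% : ∀ {X p-1 k} → Periodic X (suc p-1) k → ∀ i → i < k → X (i % suc p-1) ≡ X i
Periodic-% {X} {p-1} {k} per i i<k = sym (trans (cong X i≡) (Periodic-* per (i % p) (i / p) (subst (_< k) i≡ i<k)))
  where
    p : ℕ
    p = suc p-1
    i≡ : i ≡ i % p + i / p * p
    i≡ = m≡m%n+[m/n]*n i p

Periodic-≤ : ∀ {X q k k′} → k′ ≤ k → Periodic X q k → Periodic X q k′
Periodic-≤ k′≤k per i i+q<k′ = per i (<-≤-trans i+q<k′ k′≤k)

Periodic-extend : ∀ {X q k} → Periodic X q k → q ≤ k → X (k ∸ q) ≡ X k → Periodic X q (suc k)
Periodic-extend {X} {q} {k} per q≤k X[k-q]≡X[k] i i+q<1+k with m<1+n⇒m<n∨m≡n i+q<1+k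
... | inj₁ i+q<k  = per i i+q<k
... | inj₂ i+q≡k  = trans (cong X i≡k-q) (trans X[k-q]≡X[k] (cong X (sym i+q≡k)))
  where
    i≡k-q : i ≡ k ∸ q
    i≡k-q = trans (sym (m+n∸n≡m i q)) (cong (_∸ q) i+q≡k)

_≺⟨_⟩_ : ℕ → Bool → ℕ → Set
a ≺⟨ true  ⟩ b = a < b
a ≺⟨ false ⟩ b = b < a

≺-irrefl : ∀ o {a} → ¬ a ≺⟨ o ⟩ a
≺-irrefl true  = <-irrefl refl
≺-irrefl false = <-irrefl refl

≺-trans : ∀ o {a b c} → a ≺⟨ o ⟩ b → b ≺⟨ o ⟩ c → a ≺⟨ o ⟩ c
≺-trans true  a<b b<c = <-trans a<b b<c
≺-trans false b<a c<b = <-trans c<b b<a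

≺-cmp : ∀ o → Trichotomous _≡_ (λ a b → a ≺⟨ o ⟩ b)
≺-cmp true  = <-cmp
≺-cmp false a b with <-cmp a b
... | tri< a<b a≢b b≮a = tri> b≮a a≢b a<b
... | tri≈ a≮b a≡b b≮a = tri≈ b≮a a≡b a≮b
... | tri> a≮b a≢b b<a = tri< b<a a≢b a≮b

Agree : Word → Word → ℕ → Set
Agree X Y m = ∀ i → i < m → X i ≡ Y i

LexLess : Bool → Word → Word → ℕ → Set
LexLess o X Y m = ∃[ d ] d < m × Agree X Y d × X d ≺⟨ o ⟩ Y d

lex-cmp : ∀ o X Y m → Agree X Y m ⊎ LexLess o X Y m ⊎ LexLess o Y X m
lex-cmp o X Y zero = inj₁ (λ _ ())
lex-cmp o X Y (suc m) with lex-cmp o X Y m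
... | inj₂ (inj₁ (d , d<m , ag , lt)) = inj₂ (inj₁ (d , m<n⇒m<1+n d<m , ag , lt))
... | inj₂ (inj₂ (d , d<m , ag , lt)) = inj₂ (inj₂ (d , m<n⇒m<1+n d<m , ag , lt))
... | inj₁ ag with ≺-cmp o (X m) (Y m)
...   | tri< lt _ _ = inj₂ (inj₁ (m , ≤-refl , ag , lt))
...   | tri> _ _ gt = inj₂ (inj₂ (m , ≤-refl , (λ i i<m → sym (ag i i<m)) , gt))
...   | tri≈ _ eq _ = inj₁ λ i i<1+m → case m<1+n⇒m<n∨m≡n i<1+m of λ where
          (inj₁ i<m)  → ag i i<m
          (inj₂ refl) → eq

Agree⇒¬LexLess : ∀ o {X Y m} → Agree X Y m → ¬ LexLess o X Y m
Agree⇒¬LexLess o ag (d , d<m , _ , lt) = ≺-irrefl o (subst (λ a → a ≺⟨ o ⟩ _) (ag d d<m) lt)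

LexLess-irrefl : ∀ o X m → ¬ LexLess o X X m
LexLess-irrefl o X m = Agree⇒¬LexLess o (λ _ _ → refl)

LexLess-trans : ∀ o {X Y Z m} → LexLess o X Y m → LexLess o Y Z m → LexLess o X Z m
LexLess-trans o {X} {Y} {Z} (d₁ , d₁<m , ag₁ , lt₁) (d₂ , d₂<m , ag₂ , lt₂) with <-cmp d₁ d₂
... | tri< d₁<d₂ _ _ =
  d₁ , d₁<m , (λ i i<d₁ → trans (ag₁ i i<d₁) (ag₂ i (<-trans i<d₁ d₁<d₂))) ,
  subst (X d₁ ≺⟨ o ⟩_) (ag₂ d₁ d₁<d₂) lt₁
... | tri≈ _ refl _ =
  d₁ , d₁<m , (λ i i<d₁ → trans (ag₁ i i<d₁) (ag₂ i i<d₁)) , ≺-trans o lt₁ lt₂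
... | tri> _ _ d₂<d₁ =
  d₂ , d₂<m , (λ i i<d₂ → trans (ag₁ i (<-trans i<d₂ d₂<d₁)) (ag₂ i i<d₂)) ,
  subst (_≺⟨ o ⟩ Z d₂) (sym (ag₁ d₂ d₂<d₁)) lt₂

LexLess-respˡ : ∀ o {X X′ Y m} → (∀ i → X i ≡ X′ i) → LexLess o X Y m → LexLess o X′ Y m
LexLess-respˡ o X≗X′ (d , d<m , ag , lt) =
  d , d<m , (λ i i<d → trans (sym (X≗X′ i)) (ag i i<d)) , subst (λ a → a ≺⟨ o ⟩ _) (X≗X′ d) lt

Lyndon : Bool → Word → ℕ → Set
Lyndon o X m = ∀ k → 0 < k → k < m →
  ∃[ d ] d + k < m × Agree X (shift X k) d × X d ≺⟨ o ⟩ X (k + d)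

Lyndon-resp : ∀ o {X Y m} → Agree X Y m → Lyndon o X m → Lyndon o Y m
Lyndon-resp o {X} {Y} {m} X≈Y lyn k 0<k k<m with lyn k 0<k k<m
... | d , d+k<m , ag , lt =
  d , d+k<m , (λ i i<d → trans (sym (X≈Y i (<-trans i<d d<m))) (trans (ag i i<d) (X≈Y (k + i) (k+<m (<⇒≤ i<d))))) ,
  subst₂ (λ a b → a ≺⟨ o ⟩ b) (X≈Y d d<m) (X≈Y (k + d) (k+<m ≤-refl)) lt
  where
    d<m : d < m
    d<m = m+n≤o⇒m≤o (suc d) d+k<m
    k+<m : ∀ {i} → i ≤ d → k + i < m
    k+<m {i} i≤d = subst (_< m) (+-comm i k) (≤-<-trans (+-monoˡ-≤ k i≤d) d+k<m)

Lyndon⇒¬periodic-prefix : ∀ o X m p L → Lyndon o X m → 0 < p → p < m → p ≤ L →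
  Periodic X p L → (L < m → X L ≺⟨ o ⟩ X (L ∸ p)) → ⊥
Lyndon⇒¬periodic-prefix o X m p L lyn 0<p p<m p≤L per drop with lyn p 0<p p<m
... | d , d+p<m , ag , lt with <-cmp (d + p) L
...   | tri< d+p<L _ _ =
  ≺-irrefl o (subst (X d ≺⟨ o ⟩_) (trans (cong X (+-comm p d)) (sym (per d d+p<L))) lt)
...   | tri≈ _ d+p≡L _ = ≺-irrefl o (≺-trans o lt (subst₂ (λ a b → a ≺⟨ o ⟩ b) XL≡ XL-p≡ (drop L<m)))
  where
    L<m : L < m
    L<m = subst (_< m) d+p≡L d+p<m
    XL≡ : X L ≡ X (p + d)
    XL≡ = cong X (trans (sym d+p≡L) (+-comm d p))
    XL-p≡ : X (L ∸ p) ≡ X d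
    XL-p≡ = cong X (trans (cong (_∸ p) (sym d+p≡L)) (m+n∸n≡m d p))
...   | tri> _ _ L<d+p = ≺-irrefl o (subst (_≺⟨ o ⟩ X (L ∸ p)) XL≡ (drop (<-trans L<d+p d+p<m)))
  where
    L-p<d : L ∸ p < d
    L-p<d = +-cancelʳ-< p (L ∸ p) d (subst (_< d + p) (sym (m∸n+n≡m p≤L)) L<d+p)
    XL≡ : X L ≡ X (L ∸ p)
    XL≡ = sym (trans (ag (L ∸ p) L-p<d) (cong X (trans (+-comm p (L ∸ p)) (m∸n+n≡m p≤L))))

lex-minimum : ∀ o (F : ℕ → Word) m q →
  ∃[ j ] j < suc m × (∀ j′ → j′ < suc m → ¬ LexLess o (F j′) (F j) q)
lex-minimum o F zero q = 0 , z<s , λ where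
  zero _ → LexLess-irrefl o (F 0) q
  (suc _) (s<s ())
lex-minimum o F (suc m) q with lex-minimum o F m q
... | j , j≤m , min with lex-cmp o (F (suc m)) (F j) q
...   | inj₂ (inj₁ new<) = suc m , ≤-refl , λ j′ j′<2+m lt → case m<1+n⇒m<n∨m≡n j′<2+m of λ where
          (inj₁ j′<1+m) → min j′ j′<1+m (LexLess-trans o lt new<)
          (inj₂ refl)   → LexLess-irrefl o (F (suc m)) q lt
...   | inj₁ ag = j , m<n⇒m<1+n j≤m , λ j′ j′<2+m → case m<1+n⇒m<n∨m≡n j′<2+m of λ where
          (inj₁ j′<1+m) → min j′ j′<1+m
          (inj₂ refl)   → Agree⇒¬LexLess o ag
...   | inj₂ (inj₂ old<) = j , m<n⇒m<1+n j≤m , λ j′ j′<2+m lt → case m<1+n⇒m<n∨m≡n j′<2+m of λ where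
          (inj₁ j′<1+m) → min j′ j′<1+m lt
          (inj₂ refl)   → LexLess-irrefl o (F j) q (LexLess-trans o old< lt)

module _ {X : Word} {p-1 : ℕ} (per : Periodic∞ X (suc p-1)) where

  -- As X is p-periodic, agreement on one period is agreement everywhere.
  Agree-shift⇒Periodic∞ : ∀ {j k} → j < suc p-1 → Agree (shift X j) (shift X (j + k)) (suc p-1) → Periodic∞ X k
  Agree-shift⇒Periodic∞ {j} {k} j<p ag i = begin
    X (i + k)              ≡⟨ per (i + k) ⟨
    X (i + k + p)          ≡⟨ cong X (solve 3 (λ i k p → i :+ k :+ p := k :+ (i :+ p)) refl i k p) ⟩
    X (k + (i + p))        ≡⟨ cong (λ z → X (k + z)) (m+[n∸m]≡n j≤i+p) ⟨
    X (k + (j + y))        ≡⟨ cong X (solve 3 (λ k j y → k :+ (j :+ y) := j :+ k :+ y) refl k j y) ⟩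
    X (j + k + y)          ≡⟨ sym (everywhere y) ⟩
    X (j + y)              ≡⟨ cong X (m+[n∸m]≡n j≤i+p) ⟩
    X (i + p)              ≡⟨ per i ⟩
    X i                    ∎
    where
      open ≡-Reasoning
      p : ℕ
      p = suc p-1
      j≤i+p : j ≤ i + p
      j≤i+p = ≤-trans (<⇒≤ j<p) (m≤n+m p i)
      y : ℕ
      y = i + p ∸ j
      everywhere : ∀ y → X (j + y) ≡ X (j + k + y)
      everywhere y = begin
        X (j + y)                        ≡⟨ cong (λ z → X (j + z)) (m≡m%n+[m/n]*n y p) ⟩
        X (j + (y % p + y / p * p))      ≡⟨ cong X (sym (+-assoc j _ _)) ⟩
        X (j + y % p + y / p * p)        ≡⟨ Periodic∞-* per (j + y % p) (y / p) ⟩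
        X (j + y % p)                    ≡⟨ ag (y % p) (m%n<n y p) ⟩
        X (j + k + y % p)                ≡⟨ Periodic∞-* per (j + k + y % p) (y / p) ⟨
        X (j + k + y % p + y / p * p)    ≡⟨ cong X (+-assoc (j + k) _ _) ⟩
        X (j + k + (y % p + y / p * p))  ≡⟨ cong (λ z → X (j + k + z)) (m≡m%n+[m/n]*n y p) ⟨
        X (j + k + y)                    ∎

  lyndon-rotation : ∀ o → (∀ k → 0 < k → k < suc p-1 → ¬ Periodic∞ X k) →
    ∃[ j ] j < suc p-1 × Lyndon o (shift X j) (suc p-1)
  lyndon-rotation o prim = j , j<p , lyndon
    where
      p : ℕ
      p = suc p-1
      least : ∃[ j ] j < p × (∀ j′ → j′ < p → ¬ LexLess o (shift X j′) (shift X j) p)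
      least = lex-minimum o (shift X) p-1 p
      j : ℕ
      j = proj₁ least
      j<p : j < p
      j<p = proj₁ (proj₂ least)

      minimal : ∀ j′ → j′ < p + p → ¬ LexLess o (shift X j′) (shift X j) p
      minimal j′ j′<2p with j′ <? p
      ... | yes j′<p = proj₂ (proj₂ least) j′ j′<p
      ... | no j′≮p = proj₂ (proj₂ least) (j′ ∸ p) j′-p<p ∘ LexLess-respˡ o back
        where
          p≤j′ : p ≤ j′
          p≤j′ = ≮⇒≥ j′≮p
          j′-p<p : j′ ∸ p < p
          j′-p<p = +-cancelʳ-< p (j′ ∸ p) p (subst (_< p + p) (sym (m∸n+n≡m p≤j′)) j′<2p)
          back : ∀ i → X (j′ + i) ≡ X (j′ ∸ p + i)
          back i = begin
            X (j′ + i)           ≡⟨ cong (λ z → X (z + i)) (m∸n+n≡m p≤j′) ⟨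
            X (j′ ∸ p + p + i)   ≡⟨ cong X (solve 3 (λ a p i → a :+ p :+ i := a :+ i :+ p) refl (j′ ∸ p) p i) ⟩
            X (j′ ∸ p + i + p)   ≡⟨ per (j′ ∸ p + i) ⟩
            X (j′ ∸ p + i)       ∎
            where open ≡-Reasoning

      lyndon : Lyndon o (shift X j) p
      lyndon k 0<k k<p with lex-cmp o (shift X j) (shift X (j + k)) p
      ... | inj₁ ag = ⊥-elim (prim k 0<k k<p (Agree-shift⇒Periodic∞ j<p ag))
      ... | inj₂ (inj₂ lt) = ⊥-elim (minimal (j + k) (+-mono-< j<p k<p) lt)
      ... | inj₂ (inj₁ (d , d<p , ag , lt)) with d + k <? p
      ...   | yes d+k<p = d , d+k<p , (λ i i<d → trans (ag i i<d) (cong X (+-assoc j k i))) ,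
                          subst (shift X j d ≺⟨ o ⟩_) (cong X (+-assoc j k d)) lt
      ...   | no d+k≮p = ⊥-elim (minimal (j + s) (+-mono-<-≤ j<p (m∸n≤m p k)) (d ∸ s , d-s<p , ag′ , lt′))
        where
          -- The first difference lies past the end of shift X (j + k) within the period, so
          -- the comparison wraps around: shift X (j + s) with s = p - k is smaller than shift X j.
          s : ℕ
          s = p ∸ k
          s≤d : s ≤ d
          s≤d = ≤-trans (∸-monoˡ-≤ k (≮⇒≥ d+k≮p)) (≤-reflexive (m+n∸n≡m d k))
          s+[d-s]≡d : s + (d ∸ s) ≡ d
          s+[d-s]≡d = m+[n∸m]≡n s≤d
          d-s<p : d ∸ s < p
          d-s<p = ≤-<-trans (m∸n≤m d s) d<p
          wrap : ∀ i → X (j + k + (s + i)) ≡ X (j + i)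
          wrap i = begin
            X (j + k + (s + i))  ≡⟨ cong X (solve 4 (λ j k s i → j :+ k :+ (s :+ i) := j :+ i :+ (s :+ k)) refl j k s i) ⟩
            X (j + i + (s + k))  ≡⟨ cong (λ z → X (j + i + z)) (m∸n+n≡m (<⇒≤ k<p)) ⟩
            X (j + i + p)        ≡⟨ per (j + i) ⟩
            X (j + i)            ∎
            where open ≡-Reasoning
          ag′ : Agree (shift X (j + s)) (shift X j) (d ∸ s)
          ag′ i i<d-s = trans (cong X (+-assoc j s i))
                          (trans (ag (s + i) (subst (s + i <_) s+[d-s]≡d (+-monoʳ-< s i<d-s))) (wrap i))
          lt′ : shift X (j + s) (d ∸ s) ≺⟨ o ⟩ shift X j (d ∸ s)
          lt′ = subst₂ (λ a b → a ≺⟨ o ⟩ b)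
                  (cong X (trans (cong (j +_) (sym s+[d-s]≡d)) (sym (+-assoc j s (d ∸ s)))))
                  (trans (cong (λ z → X (j + k + z)) (sym s+[d-s]≡d)) (wrap (d ∸ s))) lt

Unique-lookup-injective : {A : Set} {xs : List A} → Unique xs → Injective _≡_ _≡_ (lookup xs)
Unique-lookup-injective {xs = x ∷ xs} (x∉xs ∷ unique) {zero}  {zero}  _  = refl
Unique-lookup-injective {xs = x ∷ xs} (x∉xs ∷ unique) {zero}  {suc j} eq = ⊥-elim (All.lookup x∉xs (∈-lookup j) eq)
Unique-lookup-injective {xs = x ∷ xs} (x∉xs ∷ unique) {suc i} {zero}  eq = ⊥-elim (All.lookup x∉xs (∈-lookup i) (sym eq))
Unique-lookup-injective {xs = x ∷ xs} (x∉xs ∷ unique) {suc i} {suc j} eq = cong suc (Unique-lookup-injective unique eq)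

Unique⇒length≤ : ∀ {m} {xs : List (Fin m)} → Unique xs → length xs ≤ m
Unique⇒length≤ unique = injective⇒≤ (Unique-lookup-injective unique)

orientedEdge : ∀ {n} → Bool → Fin n → Fin (n + n)
orientedEdge {n} true  e = e Fin.↑ˡ n
orientedEdge {n} false e = n Fin.↑ʳ e

orientedEdge-injective : ∀ {n} o o′ (e e′ : Fin n) → orientedEdge o e ≡ orientedEdge o′ e′ → o ≡ o′ × e ≡ e′
orientedEdge-injective {n} true  true  e e′ eq = refl , ↑ˡ-injective n e e′ eq
orientedEdge-injective {n} false false e e′ eq = refl , ↑ʳ-injective n e e′ eq
orientedEdge-injective {n} true  false e e′ eq
  with trans (sym (splitAt-↑ˡ n e n)) (trans (cong (Fin.splitAt n) eq) (splitAt-↑ʳ n n e′))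
... | ()
orientedEdge-injective {n} false true  e e′ eq
  with trans (sym (splitAt-↑ʳ n n e)) (trans (cong (Fin.splitAt n) eq) (splitAt-↑ˡ n e′ n))
... | ()

fraction-≤ : ∀ a b c d → a * suc d ≤ c * suc b → ℤ.+ a ℚ./ suc b ℚ.≤ ℤ.+ c ℚ./ suc d
fraction-≤ a b c d ad≤cb = ℚP.toℚᵘ-cancel-≤
  (ℚᵘP.≤-respˡ-≃ (ℚᵘP.≃-sym (ℚP.toℚᵘ-fromℚᵘ (mkℚᵘ (ℤ.+ a) b)))
    (ℚᵘP.≤-respʳ-≃ (ℚᵘP.≃-sym (ℚP.toℚᵘ-fromℚᵘ (mkℚᵘ (ℤ.+ c) d)))
      (*≤* (subst₂ ℤ._≤_ (ℤP.pos-* a (suc d)) (ℤP.pos-* c (suc b)) (ℤ.+≤+ ad≤cb)))))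

integer-+ : ∀ a b → ℤ.+ a ℚ./ 1 ℚ.+ ℤ.+ b ℚ./ 1 ≡ ℤ.+ (a + b) ℚ./ 1
integer-+ a b = ℚP.toℚᵘ-injective (ℚᵘP.≃-trans (ℚP.toℚᵘ-homo-+ (ℤ.+ a ℚ./ 1) (ℤ.+ b ℚ./ 1))
  (ℚᵘP.≃-trans (ℚᵘP.+-cong (ℚP.toℚᵘ-fromℚᵘ (mkℚᵘ (ℤ.+ a) 0)) (ℚP.toℚᵘ-fromℚᵘ (mkℚᵘ (ℤ.+ b) 0)))
    (ℚᵘP.≃-trans (*≡* (cong (ℤ._* ℤ.+ 1)
                     (trans (cong₂ ℤ._+_ (ℤP.*-identityʳ (ℤ.+ a)) (ℤP.*-identityʳ (ℤ.+ b))) (sym (ℤP.pos-+ a b)))))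
      (ℚᵘP.≃-sym (ℚP.toℚᵘ-fromℚᵘ (mkℚᵘ (ℤ.+ (a + b)) 0))))))

exponent-≡ : ∀ {A n} {T : Trie A n} (r : Run T) → exponent r ≡ ℤ.+ length (str r) ℚ./ suc (period r ∸ 1)
exponent-≡ r with period r | smallest r
... | zero  | ((() , _) , _)
... | suc _ | _ = refl

-- Coding the labels

FaithfulCode : {A : Set} {m : ℕ} → (Fin m → A) → (Fin m → ℕ) → Set
FaithfulCode f key = ∀ i j → key i ≡ key j ⇔ f i ≡ f j

-- Equality on an arbitrary set need not be decidable, but a finite family can be coded
-- faithfully by numbers up to double negation.
¬¬-faithfulCode : {A : Set} {m : ℕ} (f : Fin m → A) → ¬ ¬ (∃[ key ] FaithfulCode f key)
¬¬-faithfulCode {m = zero} f noCode = noCode ((λ ()) , λ ())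
¬¬-faithfulCode {m = suc m} f noCode = ¬¬-faithfulCode (f ∘ suc) λ (key , faithful) →
  ¬¬-excluded-middle {A = ∃[ i ] f zero ≡ f (suc i)} λ where
    (yes (i₀ , f₀≡)) → noCode (reuse key faithful i₀ f₀≡)
    (no fresh) → noCode (extend key faithful fresh)
  where
    reuse : ∀ key → FaithfulCode (f ∘ suc) key → ∀ i₀ → f zero ≡ f (suc i₀) → ∃[ key′ ] FaithfulCode f key′
    reuse key faithful i₀ f₀≡ = key′ , faithful′
      where
        key′ : Fin (suc m) → ℕ
        key′ zero = key i₀
        key′ (suc i) = key i
        faithful′ : FaithfulCode f key′
        faithful′ zero    zero    = mk⇔ (λ _ → refl) (λ _ → refl)
        faithful′ zero    (suc j) = subst (λ a → key i₀ ≡ key j ⇔ a ≡ f (suc j)) (sym f₀≡) (faithful i₀ j)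
        faithful′ (suc i) zero    = subst (λ a → key i ≡ key i₀ ⇔ f (suc i) ≡ a) (sym f₀≡) (faithful i i₀)
        faithful′ (suc i) (suc j) = faithful i j
    extend : ∀ key → FaithfulCode (f ∘ suc) key → ¬ (∃[ i ] f zero ≡ f (suc i)) → ∃[ key′ ] FaithfulCode f key′
    extend key faithful fresh = key′ , faithful′
      where
        key′ : Fin (suc m) → ℕ
        key′ zero = 0
        key′ (suc i) = suc (key i)
        faithful′ : FaithfulCode f key′
        faithful′ zero    zero    = mk⇔ (λ _ → refl) (λ _ → refl)
        faithful′ zero    (suc j) = mk⇔ (λ ()) (λ eq → ⊥-elim (fresh (j , eq)))
        faithful′ (suc i) zero    = mk⇔ (λ ()) (λ eq → ⊥-elim (fresh (i , sym eq)))
        faithful′ (suc i) (suc j) = mk⇔ (Equivalence.to (faithful i j) ∘ suc-injective)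
                                        (cong suc ∘ Equivalence.from (faithful i j))

module Paths {A : Set} {n : ℕ} (T : Trie A n) where

  Node : Set
  Node = Fin (suc n)

  NonRoot : Node → Set
  NonRoot u = u ≢ zero

  -- The root is its own parent; this junk value is never reached along a Str path.
  par : Node → Node
  par zero    = zero
  par (suc i) = parentNode T i

  anc : Node → ℕ → Node
  anc u zero    = u
  anc u (suc k) = anc (par u) k

  inEdge : (u : Node) → NonRoot u → Fin n
  inEdge zero    u≢0 = ⊥-elim (u≢0 refl)
  inEdge (suc e) _   = e

  inEdge-injective : ∀ u u′ (u≢0 : NonRoot u) (u′≢0 : NonRoot u′) → inEdge u u≢0 ≡ inEdge u′ u′≢0 → u ≡ u′
  inEdge-injective zero    _        u≢0 _    _  = ⊥-elim (u≢0 refl)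
  inEdge-injective (suc e) zero     _   u′≢0 _  = ⊥-elim (u′≢0 refl)
  inEdge-injective (suc e) (suc e′) _   _    eq = cong suc eq

  DepthAtLeast : Node → ℕ → Set
  DepthAtLeast u k = ∀ i → i < k → NonRoot (anc u i)

  DepthAtLeast-≤ : ∀ {u k k′} → k′ ≤ k → DepthAtLeast u k → DepthAtLeast u k′
  DepthAtLeast-≤ k′≤k deep i i<k′ = deep i (<-≤-trans i<k′ k′≤k)

  toℕ-parentNode : ∀ i → toℕ (parentNode T i) ≡ toℕ (parent T i)
  toℕ-parentNode i = toℕ-inject≤ (parent T i) _

  toℕ-par-≤ : ∀ u → toℕ (par u) ≤ toℕ u
  toℕ-par-≤ zero    = z≤n
  toℕ-par-≤ (suc i) = ≤-trans (≤-reflexive (toℕ-parentNode i)) (<⇒≤ (toℕ<n (parent T i)))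

  toℕ-par-< : ∀ u → NonRoot u → toℕ (par u) < toℕ u
  toℕ-par-< zero    u≢0 = ⊥-elim (u≢0 refl)
  toℕ-par-< (suc i) _   = s≤s (≤-trans (≤-reflexive (toℕ-parentNode i)) (s≤s⁻¹ (toℕ<n (parent T i))))

  toℕ-anc-≤ : ∀ u k → toℕ (anc u k) ≤ toℕ u
  toℕ-anc-≤ u zero    = ≤-refl
  toℕ-anc-≤ u (suc k) = ≤-trans (toℕ-anc-≤ (par u) k) (toℕ-par-≤ u)

  anc-+ : ∀ u a b → anc u (a + b) ≡ anc (anc u a) b
  anc-+ u zero    b = refl
  anc-+ u (suc a) b = anc-+ (par u) a b

  anc-suc : ∀ u k → anc u (suc k) ≡ par (anc u k)
  anc-suc u zero    = refl
  anc-suc u (suc k) = anc-suc (par u) k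

  anc-<⇒≢ : ∀ u {a b} → a < b → NonRoot (anc u a) → anc u a ≢ anc u b
  anc-<⇒≢ u {a} {b} a<b nonRoot eq = <-irrefl (cong toℕ (sym eq)) (begin-strict
    toℕ (anc u b)                         ≡⟨ cong (toℕ ∘ anc u) (sym (m+[n∸m]≡n (<⇒≤ a<b))) ⟩
    toℕ (anc u (a + (b ∸ a)))             ≡⟨ cong toℕ (anc-+ u a (b ∸ a)) ⟩
    toℕ (anc (anc u a) (b ∸ a))           ≡⟨ cong (toℕ ∘ anc (anc u a)) (+-∸-assoc 1 a<b) ⟩
    toℕ (anc (par (anc u a)) (b ∸ suc a)) ≤⟨ toℕ-anc-≤ _ (b ∸ suc a) ⟩
    toℕ (par (anc u a))                   <⟨ toℕ-par-< (anc u a) nonRoot ⟩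
    toℕ (anc u a)                         ∎)
    where open ≤-Reasoning

  DepthAtLeast-anc : ∀ {u} a {k} → DepthAtLeast u (a + k) → DepthAtLeast (anc u a) k
  DepthAtLeast-anc {u} a deep i i<k = subst NonRoot (anc-+ u a i) (deep (a + i) (+-monoʳ-< a i<k))

  divergence : ∀ c {u u′} → anc u c ≡ anc u′ c → u ≢ u′ →
               ∃[ s ] s < c × anc u s ≢ anc u′ s × anc u (suc s) ≡ anc u′ (suc s)
  divergence zero    same u≢u′ = ⊥-elim (u≢u′ same)
  divergence (suc c) {u} {u′} same u≢u′ with anc u c Fin.≟ anc u′ c
  ... | yes same′ = let s , s<c , rest = divergence c same′ u≢u′ in s , m<n⇒m<1+n s<c , rest
  ... | no differ = c , ≤-refl , differ , same

  Str⇒anc : ∀ {u v w} → Str T u v w → v ≡ anc u (length w)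
  Str⇒anc (here u) = refl
  Str⇒anc (up i s) = Str⇒anc s

  Str⇒DepthAtLeast : ∀ {u v w} → Str T u v w → DepthAtLeast u (length w)
  Str⇒DepthAtLeast (here u) i ()
  Str⇒DepthAtLeast (up i s) zero    _         ()
  Str⇒DepthAtLeast (up i s) (suc k) (s≤s k<) = Str⇒DepthAtLeast s k k<

  Str-lookup : ∀ {u v w} → Str T u v w → (i : Fin (length w)) →
               ∃[ e ] anc u (toℕ i) ≡ suc e × lookup w i ≡ label T e
  Str-lookup (up e s) zero    = e , refl , refl
  Str-lookup (up e s) (suc i) = Str-lookup s i

  upward-Str : ∀ u k → DepthAtLeast u k → ∃[ w ] Str T u (anc u k) w × length w ≡ k
  upward-Str u       zero    deep = [] , here u , refl
  upward-Str zero    (suc k) deep = ⊥-elim (deep 0 z<s refl)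
  upward-Str (suc e) (suc k) deep with upward-Str (parentNode T e) k (λ i i<k → deep (suc i) (s≤s i<k))
  ... | w , s , |w|≡k = label T e ∷ w , up e s , cong suc |w|≡k

-- Runs as periodic words of codes

module Codes {A : Set} {n : ℕ} (T : Trie A n) (key : Fin n → ℕ) (faithful : FaithfulCode (label T) key) where
  open Paths T public

  -- The root has no label; its code is never read inside a run.
  code : Node → ℕ
  code zero    = 0
  code (suc e) = key e

  codes : Node → Word
  codes u i = code (anc u i)

  codes-anc : ∀ u a b → codes (anc u a) b ≡ codes u (a + b)
  codes-anc u a b = cong code (sym (anc-+ u a b))

  siblings-≡ : ∀ y y′ → NonRoot y → NonRoot y′ → par y ≡ par y′ → code y ≡ code y′ → y ≡ y′
  siblings-≡ zero    _        y≢0 _    _  _  = ⊥-elim (y≢0 refl)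
  siblings-≡ (suc e) zero     _   y′≢0 _  _  = ⊥-elim (y′≢0 refl)
  siblings-≡ (suc e) (suc e′) _   _    pe ce = cong suc (distinct T e e′ same-parent (Equivalence.to (faithful e e′) ce))
    where
      same-parent : toℕ (parent T e) ≡ toℕ (parent T e′)
      same-parent = trans (sym (toℕ-parentNode e)) (trans (cong toℕ pe) (toℕ-parentNode e′))

  Str-lookup-≡ : ∀ {u v w} → Str T u v w → (i j : Fin (length w)) →
                 lookup w i ≡ lookup w j ⇔ codes u (toℕ i) ≡ codes u (toℕ j)
  Str-lookup-≡ s i j with Str-lookup s i | Str-lookup s j
  ... | e , uᵢ≡ , wᵢ≡ | e′ , uⱼ≡ , wⱼ≡ = mk⇔
    (λ wᵢ≡wⱼ → trans (cong code uᵢ≡) (trans (Equivalence.from (faithful e e′) (trans (sym wᵢ≡) (trans wᵢ≡wⱼ wⱼ≡)))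
                  (cong code (sym uⱼ≡))))
    (λ cᵢ≡cⱼ → trans wᵢ≡ (trans (Equivalence.to (faithful e e′)
                                   (trans (cong code (sym uᵢ≡)) (trans cᵢ≡cⱼ (cong code uⱼ≡))))
                  (sym wⱼ≡)))

  IsPeriod⇒Periodic : ∀ {u v w q} → Str T u v w → IsPeriod w q → Periodic (codes u) q (length w)
  IsPeriod⇒Periodic {u} {w = w} {q} s (_ , _ , per) i i+q<|w| =
    subst₂ (λ a b → codes u a ≡ codes u b) (toℕ-fromℕ< i<|w|) (toℕ-fromℕ< i+q<|w|)
      (Equivalence.to (Str-lookup-≡ s fi fj) (per fi fj (trans (toℕ-fromℕ< i+q<|w|) (cong (_+ q) (sym (toℕ-fromℕ< i<|w|))))))
    where
      i<|w| : i < length w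
      i<|w| = m+n≤o⇒m≤o (suc i) i+q<|w|
      fi fj : Fin (length w)
      fi = Fin.fromℕ< i<|w|
      fj = Fin.fromℕ< i+q<|w|

  Periodic⇒IsPeriod : ∀ {u v w q} → Str T u v w → 1 ≤ q → q ≤ length w → Periodic (codes u) q (length w) → IsPeriod w q
  Periodic⇒IsPeriod {u} {w = w} s 1≤q q≤|w| per = 1≤q , q≤|w| , λ i j j≡i+q →
    Equivalence.from (Str-lookup-≡ s i j)
      (trans (per (toℕ i) (subst (_< length w) j≡i+q (toℕ<n j))) (cong (codes u) (sym j≡i+q)))

  Periodic-anc : ∀ {u q k} a {m} → Periodic (codes u) q k → a + m ≤ k → Periodic (codes (anc u a)) q m
  Periodic-anc {u} {q} a {m} per a+m≤k i i+q<m = begin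
    codes (anc u a) i        ≡⟨ codes-anc u a i ⟩
    codes u (a + i)          ≡⟨ per (a + i) (<-≤-trans a+i+q<a+m a+m≤k) ⟩
    codes u (a + i + q)      ≡⟨ cong (codes u) (+-assoc a i q) ⟩
    codes u (a + (i + q))    ≡⟨ codes-anc u a (i + q) ⟨
    codes (anc u a) (i + q)  ∎
    where
      open ≡-Reasoning
      a+i+q<a+m : a + i + q < a + m
      a+i+q<a+m = subst (_< a + m) (sym (+-assoc a i q)) (+-monoʳ-< a i+q<m)

  -- A run of period p = suc p-1, read as the word of codes from its lower end lo upwards.
  record CodedRun (p-1 : ℕ) : Set where
    p : ℕ
    p = suc p-1
    field
      lo              : Node
      ℓ               : ℕ
      deep            : DepthAtLeast lo ℓ
      square          : p + p ≤ ℓ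
      periodic        : Periodic (codes lo) p ℓ
      noSmallerPeriod : ∀ q → 0 < q → q < p → ¬ Periodic (codes lo) q ℓ
      rightMaximal    : NonRoot (anc lo ℓ) → ¬ Periodic (codes lo) p (suc ℓ)
      leftMaximal     : ∀ u a → anc u a ≡ lo → 0 < a → DepthAtLeast u (a + ℓ) → ¬ Periodic (codes u) p (a + ℓ)

    top : Node
    top = anc lo ℓ

  module FromRun (r : Run T) where

    ℓ : ℕ
    ℓ = length (str r)

    p-1 : ℕ
    p-1 = period r ∸ 1

    private
      p≡period : suc p-1 ≡ period r
      p≡period = m+[n∸m]≡n (proj₁ (proj₁ (smallest r)))

      p : ℕ
      p = suc p-1

      s : Str T (lower r) (upper r) (str r)
      s = path r

      smallest′ : IsSmallestPeriod (str r) p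
      smallest′ = subst (IsSmallestPeriod (str r)) (sym p≡period) (smallest r)

      p≤ℓ : p ≤ ℓ
      p≤ℓ = proj₁ (proj₂ (proj₁ smallest′))

      deep : DepthAtLeast (lower r) ℓ
      deep = Str⇒DepthAtLeast s

    top≡upper : anc (lower r) ℓ ≡ upper r
    top≡upper = sym (Str⇒anc s)

    private
      extension-smallest : ∀ {u v w} a → Str T u v w → anc u a ≡ lower r → a + ℓ ≤ length w →
                           Periodic (codes u) p (length w) → IsSmallestPeriod w p
      extension-smallest {w = w} a s′ anc≡lower a+ℓ≤|w| per =
        Periodic⇒IsPeriod s′ (s≤s z≤n) (≤-trans p≤ℓ (≤-trans (m≤n+m ℓ a) a+ℓ≤|w|)) per , least
        where
          least : ∀ q → IsPeriod w q → p ≤ q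
          least q q-period with q ≤? ℓ
          ... | no q≰ℓ  = ≤-trans p≤ℓ (<⇒≤ (≰⇒> q≰ℓ))
          ... | yes q≤ℓ = proj₂ smallest′ q (Periodic⇒IsPeriod s (proj₁ q-period) q≤ℓ
                  (subst (λ z → Periodic (codes z) q ℓ) anc≡lower
                    (Periodic-anc a (IsPeriod⇒Periodic s′ q-period) a+ℓ≤|w|)))

      ¬extension : ∀ {u v x y w} → Str T u (lower r) x → Str T (upper r) v y → (u , v) ≢ endpoints r →
                   Str T u v w → ¬ IsSmallestPeriod w p
      ¬extension {w = w} x y ≢ends s′ = subst (λ q → ¬ IsSmallestPeriod w q) (sym p≡period) (maximal r _ _ _ _ x y ≢ends w s′)

      rightMaximal : NonRoot (anc (lower r) ℓ) → ¬ Periodic (codes (lower r)) p (suc ℓ)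
      rightMaximal nonRoot per with upward-Str (lower r) (suc ℓ) deeper | upward-Str (anc (lower r) ℓ) 1 last
        where
          deeper : DepthAtLeast (lower r) (suc ℓ)
          deeper i i<1+ℓ with m<1+n⇒m<n∨m≡n i<1+ℓ
          ... | inj₁ i<ℓ  = deep i i<ℓ
          ... | inj₂ refl = nonRoot
          last : DepthAtLeast (anc (lower r) ℓ) 1
          last zero    _         = nonRoot
          last (suc _) (s≤s ())
      ... | w , s′ , |w|≡1+ℓ | y , step , _ =
        ¬extension (here (lower r)) (subst₂ (λ a b → Str T a b y) top≡upper (sym (anc-suc (lower r) ℓ)) step) ≢ends s′
          (extension-smallest 0 s′ refl (≤-trans (n≤1+n ℓ) (≤-reflexive (sym |w|≡1+ℓ)))
            (subst (Periodic (codes (lower r)) p) (sym |w|≡1+ℓ) per))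
        where
          ≢ends : (lower r , anc (lower r) (suc ℓ)) ≢ endpoints r
          ≢ends eq = anc-<⇒≢ (lower r) {ℓ} ≤-refl nonRoot (trans top≡upper (sym (cong proj₂ eq)))

      leftMaximal : ∀ u a → anc u a ≡ lower r → 0 < a → DepthAtLeast u (a + ℓ) → ¬ Periodic (codes u) p (a + ℓ)
      leftMaximal u a anc≡lower 0<a deep′ per
        with upward-Str u a (DepthAtLeast-≤ (m≤m+n a ℓ) deep′) | upward-Str u (a + ℓ) deep′
      ... | x , below , _ | w , s′ , |w|≡a+ℓ =
        ¬extension (subst (λ z → Str T u z x) anc≡lower below) (here (upper r)) ≢ends
          (subst (λ z → Str T u z w) anc≡upper s′)
          (extension-smallest a s′ anc≡lower (≤-reflexive (sym |w|≡a+ℓ)) (subst (Periodic (codes u) p) (sym |w|≡a+ℓ) per))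
        where
          anc≡upper : anc u (a + ℓ) ≡ upper r
          anc≡upper = trans (anc-+ u a ℓ) (trans (cong (λ z → anc z ℓ) anc≡lower) top≡upper)
          ≢ends : (u , upper r) ≢ endpoints r
          ≢ends eq = anc-<⇒≢ u 0<a (deep′ 0 (≤-trans 0<a (m≤m+n a ℓ))) (trans (cong proj₁ eq) (sym anc≡lower))

    codedRun : CodedRun p-1
    codedRun = record
      { lo              = lower r
      ; ℓ               = ℓ
      ; deep            = deep
      ; square          = subst (_≤ ℓ) (cong (p +_) (+-identityʳ p)) (subst (λ q → 2 * q ≤ ℓ) (sym p≡period) (squared r))
      ; periodic        = IsPeriod⇒Periodic s (proj₁ smallest′)
      ; noSmallerPeriod = λ q 0<q q<p per → <⇒≱ q<p (proj₂ smallest′ q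
                            (Periodic⇒IsPeriod s 0<q (≤-trans (<⇒≤ q<p) p≤ℓ) per))
      ; rightMaximal    = rightMaximal
      ; leftMaximal     = leftMaximal
      }

  module LyndonRoots {p-1 : ℕ} (R : CodedRun p-1) where
    open CodedRun R

    X : Word
    X i = codes lo (i % p)

    X-periodic : Periodic∞ X p
    X-periodic i = cong (codes lo) ([m+n]%n≡m%n i p)

    X-primitive : ∀ k → 0 < k → k < p → ¬ Periodic∞ X k
    X-primitive k 0<k k<p X-k-periodic = noSmallerPeriod k 0<k k<p λ i i+k<ℓ →
      trans (sym (Periodic-% periodic i (m+n≤o⇒m≤o (suc i) i+k<ℓ)))
        (trans (sym (X-k-periodic i)) (Periodic-% periodic (i + k) i+k<ℓ))

    p≤ℓ : p ≤ ℓ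
    p≤ℓ = ≤-trans (m≤m+n p p) square

    -- Above a run the next letter differs from the one p below it (right maximality); the
    -- orientation is chosen to make it smaller, and is arbitrary when the run reaches the root.
    oriented-drop : ∃[ o ] (NonRoot top → codes lo ℓ ≺⟨ o ⟩ codes lo (ℓ ∸ p))
    oriented-drop with top Fin.≟ zero
    ... | yes top≡0 = true , λ nonRoot → ⊥-elim (nonRoot top≡0)
    ... | no nonRoot with <-cmp (codes lo ℓ) (codes lo (ℓ ∸ p))
    ...   | tri< lt _ _ = true , λ _ → lt
    ...   | tri≈ _ eq _ = ⊥-elim (rightMaximal nonRoot (Periodic-extend periodic p≤ℓ (sym eq)))
    ...   | tri> _ _ gt = false , λ _ → gt

    orientation : Bool
    orientation = proj₁ oriented-drop

    drop : NonRoot top → codes lo ℓ ≺⟨ orientation ⟩ codes lo (ℓ ∸ p)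
    drop = proj₂ oriented-drop

    rotation : ∃[ j ] j < p × Lyndon orientation (shift X j) p
    rotation = lyndon-rotation X-periodic orientation X-primitive

    rootAt : ℕ → ℕ
    rootAt t = proj₁ rotation + t * p

    rootCount : ℕ
    rootCount = ℓ / p ∸ 1

    2≤ℓ/p : 2 ≤ ℓ / p
    2≤ℓ/p = subst (_≤ ℓ / p) (m*n/n≡m 2 p)
              (/-monoˡ-≤ p (subst (_≤ ℓ) (solve 1 (λ p → p :+ p := con 2 :* p) refl p) square))

    rootAt-fits : ∀ t → t < rootCount → rootAt t + p ≤ ℓ
    rootAt-fits t t<count = begin
      proj₁ rotation + t * p + p  ≤⟨ +-monoˡ-≤ p (+-monoˡ-≤ (t * p) (<⇒≤ (proj₁ (proj₂ rotation)))) ⟩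
      p + t * p + p               ≡⟨ solve 2 (λ t p → p :+ t :* p :+ p := (con 2 :+ t) :* p) refl t p ⟩
      (2 + t) * p                 ≤⟨ *-monoˡ-≤ p 2+t≤ℓ/p ⟩
      ℓ / p * p                   ≤⟨ m/n*n≤m ℓ p ⟩
      ℓ                           ∎
      where
        open ≤-Reasoning
        2+t≤ℓ/p : 2 + t ≤ ℓ / p
        2+t≤ℓ/p = subst (2 + t ≤_) (m∸n+n≡m (≤-trans (s≤s z≤n) 2≤ℓ/p))
                    (subst (_≤ rootCount + 1) (+-comm (suc t) 1) (+-monoˡ-≤ 1 t<count))

    rootNode : ℕ → Node
    rootNode t = anc lo (rootAt t)

    rootNode-lyndon : ∀ t → t < rootCount → Lyndon orientation (codes (rootNode t)) p
    rootNode-lyndon t t<count = Lyndon-resp orientation agree (proj₂ (proj₂ rotation))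
      where
        j : ℕ
        j = proj₁ rotation
        agree : Agree (shift X j) (codes (rootNode t)) p
        agree i i<p = sym (begin
          codes (rootNode t) i         ≡⟨ codes-anc lo (rootAt t) i ⟩
          codes lo (rootAt t + i)      ≡⟨ Periodic-% periodic (rootAt t + i)
                                            (<-≤-trans (+-monoʳ-< (rootAt t) i<p) (rootAt-fits t t<count)) ⟨
          X (rootAt t + i)             ≡⟨ cong X (solve 3 (λ j i tp → j :+ tp :+ i := j :+ i :+ tp) refl j i (t * p)) ⟩
          X (j + i + t * p)            ≡⟨ Periodic∞-* X-periodic (j + i) t ⟩
          X (j + i)                    ∎)
          where open ≡-Reasoning

    ℓ≤3*rootCount*p : ℓ ≤ 3 * rootCount * p
    ℓ≤3*rootCount*p = begin
      ℓ                      <⟨ ℓ<[1+ℓ/p]*p ⟩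
      suc (ℓ / p) * p        ≤⟨ *-monoˡ-≤ p (1+q≤3*[q-1] (ℓ / p) 2≤ℓ/p) ⟩
      3 * rootCount * p      ∎
      where
        open ≤-Reasoning
        ℓ<[1+ℓ/p]*p : ℓ < suc (ℓ / p) * p
        ℓ<[1+ℓ/p]*p = subst (_< suc (ℓ / p) * p) (sym (m≡m%n+[m/n]*n ℓ p)) (+-monoˡ-< (ℓ / p * p) (m%n<n ℓ p))
        1+q≤3*[q-1] : ∀ q → 2 ≤ q → suc q ≤ 3 * (q ∸ 1)
        1+q≤3*[q-1] (suc zero)    (s≤s ())
        1+q≤3*[q-1] (suc (suc q)) _ = subst (3 + q ≤_) (solve 1 (λ q → con 3 :+ (q :+ (q :+ q)) := con 3 :* (con 1 :+ q)) refl q)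
                                        (+-monoʳ-≤ 3 (m≤m+n q (q + q)))

    restAt : ℕ → ℕ
    restAt t = ℓ ∸ rootAt t

    rootAt+restAt : ∀ t → t < rootCount → rootAt t + restAt t ≡ ℓ
    rootAt+restAt t t<count = m+[n∸m]≡n (m+n≤o⇒m≤o (rootAt t) (rootAt-fits t t<count))

    p≤restAt : ∀ t → t < rootCount → p ≤ restAt t
    p≤restAt t t<count = +-cancelˡ-≤ (rootAt t) p (restAt t)
                           (subst (rootAt t + p ≤_) (sym (rootAt+restAt t t<count)) (rootAt-fits t t<count))

    rootNode-nonRoot : ∀ t → t < rootCount → NonRoot (rootNode t)
    rootNode-nonRoot t t<count = deep (rootAt t) (<-≤-trans (m<m+n (rootAt t) z<s) (rootAt-fits t t<count))

    rootAt-< : ∀ {t t′} → t < t′ → rootAt t < rootAt t′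
    rootAt-< t<t′ = +-monoʳ-< (proj₁ rotation) (*-monoˡ-< p t<t′)

    rootNode-injective : ∀ {t t′} → t < rootCount → t′ < rootCount → rootNode t ≡ rootNode t′ → t ≡ t′
    rootNode-injective {t} {t′} t<count t′<count same with <-cmp t t′
    ... | tri< t<t′ _ _ = ⊥-elim (anc-<⇒≢ lo (rootAt-< t<t′) (rootNode-nonRoot t t<count) same)
    ... | tri≈ _ t≡t′ _ = t≡t′
    ... | tri> _ _ t′<t = ⊥-elim (anc-<⇒≢ lo (rootAt-< t′<t) (rootNode-nonRoot t′ t′<count) (sym same))

    module _ {x L} (x+L≡ℓ : x + L ≡ ℓ) where

      periodic-above : Periodic (codes (anc lo x)) p L
      periodic-above = Periodic-anc x periodic (≤-reflexive x+L≡ℓ)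

      deep-above : DepthAtLeast (anc lo x) L
      deep-above = DepthAtLeast-anc x (subst (DepthAtLeast lo) (sym x+L≡ℓ) deep)

      top-above : anc (anc lo x) L ≡ top
      top-above = trans (sym (anc-+ lo x L)) (cong (anc lo) x+L≡ℓ)

      drop-above : p ≤ L → NonRoot (anc (anc lo x) L) → codes (anc lo x) L ≺⟨ orientation ⟩ codes (anc lo x) (L ∸ p)
      drop-above p≤L nonRoot = subst₂ (λ a b → a ≺⟨ orientation ⟩ b)
        (sym (trans (codes-anc lo x L) (cong (codes lo) x+L≡ℓ)))
        (sym (trans (codes-anc lo x (L ∸ p)) (cong (codes lo) (trans (sym (+-∸-assoc x p≤L)) (cong (_∸ p) x+L≡ℓ)))))
        (drop (subst NonRoot top-above nonRoot))

  -- Distinct runs have distinct Lyndon roots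

  -- Reading downwards, periodicity dictates every next code, and siblings carry distinct codes.
  periodic-descendants-≡ : ∀ {u u′ c p-1} → anc u c ≡ anc u′ c → DepthAtLeast u c → DepthAtLeast u′ c →
    Periodic (codes u) (suc p-1) (c + suc p-1) → Periodic (codes u′) (suc p-1) (c + suc p-1) → u ≡ u′
  periodic-descendants-≡ {u} {u′} {c} {p-1} same deep deep′ per per′ with u Fin.≟ u′
  ... | yes u≡u′ = u≡u′
  ... | no u≢u′ with divergence c same u≢u′
  ...   | s , s<c , differ , same-parent = ⊥-elim (differ (siblings-≡ _ _ (deep s s<c) (deep′ s s<c) parents codes≡))
    where
      parents : par (anc u s) ≡ par (anc u′ s)
      parents = trans (sym (anc-suc u s)) (trans same-parent (anc-suc u′ s))
      period-above : ∀ v → anc v (s + suc p-1) ≡ anc (anc v (suc s)) p-1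
      period-above v = trans (cong (anc v) (+-suc s p-1)) (anc-+ v (suc s) p-1)
      s+p<c+p : s + suc p-1 < c + suc p-1
      s+p<c+p = +-monoˡ-< (suc p-1) s<c
      codes≡ : code (anc u s) ≡ code (anc u′ s)
      codes≡ = begin
        codes u s                                 ≡⟨ per s s+p<c+p ⟩
        codes u (s + suc p-1)                     ≡⟨ cong code (period-above u) ⟩
        code (anc (anc u (suc s)) p-1)            ≡⟨ cong (λ v → code (anc v p-1)) same-parent ⟩
        code (anc (anc u′ (suc s)) p-1)           ≡⟨ cong code (period-above u′) ⟨
        codes u′ (s + suc p-1)                    ≡⟨ per′ s s+p<c+p ⟨
        codes u′ s                                ∎
        where open ≡-Reasoning

  lyndon-period-≤ : ∀ {u o p q L} → Lyndon o (codes u) q → DepthAtLeast u q → 0 < p → p ≤ L →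
    Periodic (codes u) p L → (NonRoot (anc u L) → codes u L ≺⟨ o ⟩ codes u (L ∸ p)) → q ≤ p
  lyndon-period-≤ {u} {o} {p} {q} {L} lyn deep 0<p p≤L per drop = ≮⇒≥ λ p<q →
    Lyndon⇒¬periodic-prefix o (codes u) q p L lyn 0<p p<q p≤L per (λ L<q → drop (deep L L<q))

  periodic-length-≤ : ∀ {u o p L L′} → p ≤ L → Periodic (codes u) p L′ → DepthAtLeast u L′ →
    (NonRoot (anc u L) → codes u L ≺⟨ o ⟩ codes u (L ∸ p)) → L′ ≤ L
  periodic-length-≤ {u} {o} {p} {L} {L′} p≤L per deep drop = ≮⇒≥ λ L<L′ →
    ≺-irrefl o (subst (codes u L ≺⟨ o ⟩_) (codes[L-p]≡codes[L] L<L′) (drop (deep L L<L′)))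
    where
      codes[L-p]≡codes[L] : L < L′ → codes u (L ∸ p) ≡ codes u L
      codes[L-p]≡codes[L] L<L′ =
        trans (per (L ∸ p) (subst (_< L′) (sym (m∸n+n≡m p≤L)) L<L′)) (cong (codes u) (m∸n+n≡m p≤L))

  open LyndonRoots
  open CodedRun using (lo; ℓ; top; deep; periodic; leftMaximal)

  root-period-≤ : ∀ {q₁ q₂} (R₁ : CodedRun q₁) (R₂ : CodedRun q₂) {t₁ t₂} →
    t₁ < rootCount R₁ → t₂ < rootCount R₂ → orientation R₁ ≡ orientation R₂ → rootNode R₁ t₁ ≡ rootNode R₂ t₂ →
    suc q₂ ≤ suc q₁
  root-period-≤ {q₁} {q₂} R₁ R₂ {t₁} {t₂} t₁<count t₂<count same-o shared =
    lyndon-period-≤ lyndon₂ deep₂ z<s (p≤restAt R₁ t₁ t₁<count)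
      (periodic-above R₁ split₁) (drop-above R₁ split₁ (p≤restAt R₁ t₁ t₁<count))
    where
      split₁ : rootAt R₁ t₁ + restAt R₁ t₁ ≡ ℓ R₁
      split₁ = rootAt+restAt R₁ t₁ t₁<count
      split₂ : rootAt R₂ t₂ + restAt R₂ t₂ ≡ ℓ R₂
      split₂ = rootAt+restAt R₂ t₂ t₂<count
      lyndon₂ : Lyndon (orientation R₁) (codes (rootNode R₁ t₁)) (suc q₂)
      lyndon₂ = subst₂ (λ o u → Lyndon o (codes u) (suc q₂)) (sym same-o) (sym shared)
                  (rootNode-lyndon R₂ t₂ t₂<count)
      deep₂ : DepthAtLeast (rootNode R₁ t₁) (suc q₂)
      deep₂ = subst (λ u → DepthAtLeast u (suc q₂)) (sym shared)
                (DepthAtLeast-≤ (p≤restAt R₂ t₂ t₂<count) (deep-above R₂ split₂))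

  rest-≤ : ∀ {q} (R₁ R₂ : CodedRun q) {x₁ x₂ L₁ L₂} →
    x₁ + L₁ ≡ ℓ R₁ → x₂ + L₂ ≡ ℓ R₂ → suc q ≤ L₁ → anc (lo R₁) x₁ ≡ anc (lo R₂) x₂ → L₂ ≤ L₁
  rest-≤ {q} R₁ R₂ {L₂ = L₂} split₁ split₂ p≤L₁ shared = periodic-length-≤ p≤L₁
    (subst (λ u → Periodic (codes u) (suc q) L₂) (sym shared) (periodic-above R₂ split₂))
    (subst (λ u → DepthAtLeast u L₂) (sym shared) (deep-above R₂ split₂))
    (drop-above R₁ split₁ p≤L₁)

  -- Below the shared node, periodicity leads R₂ through lo R₁, a levels above lo R₂;
  -- a > 0 would extend R₁ downwards.
  bottom-≡ : ∀ {q} (R₁ R₂ : CodedRun q) {x₁ x₂ L} →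
    x₁ ≤ x₂ → x₁ + L ≡ ℓ R₁ → x₂ + L ≡ ℓ R₂ → suc q ≤ L → anc (lo R₁) x₁ ≡ anc (lo R₂) x₂ → lo R₁ ≡ lo R₂
  bottom-≡ {q} R₁ R₂ {x₁} {x₂} {L} x₁≤x₂ split₁ split₂ p≤L shared = by-cases (a ≟ 0)
    where
      a : ℕ
      a = x₂ ∸ x₁
      a+x₁≡x₂ : a + x₁ ≡ x₂
      a+x₁≡x₂ = m∸n+n≡m x₁≤x₂
      ℓ₂≡a+ℓ₁ : ℓ R₂ ≡ a + ℓ R₁
      ℓ₂≡a+ℓ₁ = begin
        ℓ R₂          ≡⟨ split₂ ⟨
        x₂ + L        ≡⟨ cong (_+ L) a+x₁≡x₂ ⟨
        a + x₁ + L    ≡⟨ +-assoc a x₁ L ⟩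
        a + (x₁ + L)  ≡⟨ cong (a +_) split₁ ⟩
        a + ℓ R₁      ∎
        where open ≡-Reasoning
      x+p≤ℓ : ∀ {x ℓ′} → x + L ≡ ℓ′ → x + suc q ≤ ℓ′
      x+p≤ℓ {x} split = subst (x + suc q ≤_) split (+-monoʳ-≤ x p≤L)
      a+[x₁+p]≤ℓ₂ : a + (x₁ + suc q) ≤ ℓ R₂
      a+[x₁+p]≤ℓ₂ = subst (_≤ ℓ R₂) (trans (cong (_+ suc q) (sym a+x₁≡x₂)) (+-assoc a x₁ (suc q))) (x+p≤ℓ split₂)
      below₂≡lo₁ : anc (lo R₂) a ≡ lo R₁
      below₂≡lo₁ = periodic-descendants-≡ {c = x₁}
        (trans (sym (anc-+ (lo R₂) a x₁)) (trans (cong (anc (lo R₂)) a+x₁≡x₂) (sym shared)))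
        (DepthAtLeast-anc a (DepthAtLeast-≤ (≤-trans (+-monoʳ-≤ a (m≤m+n x₁ (suc q))) a+[x₁+p]≤ℓ₂) (deep R₂)))
        (DepthAtLeast-≤ (≤-trans (m≤m+n x₁ _) (x+p≤ℓ split₁)) (deep R₁))
        (Periodic-anc a (periodic R₂) a+[x₁+p]≤ℓ₂)
        (Periodic-≤ (x+p≤ℓ split₁) (periodic R₁))
      by-cases : Dec (a ≡ 0) → lo R₁ ≡ lo R₂
      by-cases (yes a≡0) = sym (trans (cong (anc (lo R₂)) (sym a≡0)) below₂≡lo₁)
      by-cases (no a≢0)  = ⊥-elim (leftMaximal R₁ (lo R₂) a below₂≡lo₁ (n≢0⇒n>0 a≢0)
                             (subst (DepthAtLeast (lo R₂)) ℓ₂≡a+ℓ₁ (deep R₂))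
                             (subst (Periodic (codes (lo R₂)) (suc q)) ℓ₂≡a+ℓ₁ (periodic R₂)))

  same-run : ∀ {q₁ q₂} → q₁ ≡ q₂ → (R₁ : CodedRun q₁) (R₂ : CodedRun q₂) → ∀ {x₁ x₂ L₁ L₂} →
    x₁ + L₁ ≡ ℓ R₁ → x₂ + L₂ ≡ ℓ R₂ → suc q₁ ≤ L₁ → suc q₂ ≤ L₂ → anc (lo R₁) x₁ ≡ anc (lo R₂) x₂ →
    lo R₁ ≡ lo R₂ × top R₁ ≡ top R₂
  same-run refl R₁ R₂ {x₁} {x₂} {L₁} split₁ split₂ p≤L₁ p≤L₂ shared
    with ≤-antisym (rest-≤ R₂ R₁ split₂ split₁ p≤L₂ (sym shared)) (rest-≤ R₁ R₂ split₁ split₂ p≤L₁ shared)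
  ... | refl = bottoms ,
    trans (sym (top-above R₁ {x₁} {L₁} split₁)) (trans (cong (λ v → anc v L₁) shared) (top-above R₂ {x₂} {L₁} split₂))
    where
      bottoms : lo R₁ ≡ lo R₂
      bottoms with ≤-total x₁ x₂
      ... | inj₁ x₁≤x₂ = bottom-≡ R₁ R₂ x₁≤x₂ split₁ split₂ p≤L₁ shared
      ... | inj₂ x₂≤x₁ = sym (bottom-≡ R₂ R₁ x₂≤x₁ split₂ split₁ p≤L₁ (sym shared))

  root-injective : ∀ {q₁ q₂} (R₁ : CodedRun q₁) (R₂ : CodedRun q₂) {t₁ t₂} →
    t₁ < rootCount R₁ → t₂ < rootCount R₂ → orientation R₁ ≡ orientation R₂ → rootNode R₁ t₁ ≡ rootNode R₂ t₂ →
    lo R₁ ≡ lo R₂ × top R₁ ≡ top R₂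
  root-injective {q₁} {q₂} R₁ R₂ {t₁} {t₂} t₁<count t₂<count same-o shared = same-run same-period R₁ R₂
    (rootAt+restAt R₁ t₁ t₁<count) (rootAt+restAt R₂ t₂ t₂<count)
    (p≤restAt R₁ t₁ t₁<count) (p≤restAt R₂ t₂ t₂<count) shared
    where
      same-period : q₁ ≡ q₂
      same-period = suc-injective (≤-antisym (root-period-≤ R₂ R₁ t₂<count t₁<count (sym same-o) (sym shared))
                                             (root-period-≤ R₁ R₂ t₁<count t₂<count same-o shared))

  -- Counting the roots

  open FromRun using (codedRun; top≡upper)

  rootSlot : ∀ {q} (R : CodedRun q) → Fin (rootCount R) → Fin (n + n)
  rootSlot R t = orientedEdge (orientation R) (inEdge (rootNode R (toℕ t)) (rootNode-nonRoot R (toℕ t) (toℕ<n t)))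

  rootSlot-injective : ∀ {q₁ q₂} (R₁ : CodedRun q₁) (R₂ : CodedRun q₂) t₁ t₂ → rootSlot R₁ t₁ ≡ rootSlot R₂ t₂ →
                       orientation R₁ ≡ orientation R₂ × rootNode R₁ (toℕ t₁) ≡ rootNode R₂ (toℕ t₂)
  rootSlot-injective R₁ R₂ t₁ t₂ same with orientedEdge-injective _ _ _ _ same
  ... | same-o , same-e = same-o , inEdge-injective _ _ _ _ same-e

  slots : Run T → List (Fin (n + n))
  slots r = tabulate (rootSlot (codedRun r))

  slots-unique : ∀ r → Unique (slots r)
  slots-unique r = tabulate⁺ λ {t₁} {t₂} same →
    toℕ-injective (rootNode-injective R (toℕ<n t₁) (toℕ<n t₂) (proj₂ (rootSlot-injective R R t₁ t₂ same)))
    where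
      R : CodedRun (FromRun.p-1 r)
      R = codedRun r

  slots-disjoint : ∀ r r′ → endpoints r ≢ endpoints r′ → Disjoint (slots r) (slots r′)
  slots-disjoint r r′ ≢ends (v∈ , v∈′) = ≢ends (cong₂ _,_ (proj₁ same-ends)
    (trans (sym (top≡upper r)) (trans (proj₂ same-ends) (top≡upper r′))))
    where
      R : CodedRun (FromRun.p-1 r)
      R = codedRun r
      R′ : CodedRun (FromRun.p-1 r′)
      R′ = codedRun r′
      t : Fin (rootCount R)
      t = proj₁ (∈-tabulate⁻ v∈)
      t′ : Fin (rootCount R′)
      t′ = proj₁ (∈-tabulate⁻ v∈′)
      same-slot : orientation R ≡ orientation R′ × rootNode R (toℕ t) ≡ rootNode R′ (toℕ t′)
      same-slot = rootSlot-injective R R′ t t′ (trans (sym (proj₂ (∈-tabulate⁻ v∈))) (proj₂ (∈-tabulate⁻ v∈′)))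
      same-ends : lo R ≡ lo R′ × top R ≡ top R′
      same-ends = root-injective R R′ (toℕ<n t) (toℕ<n t′) (proj₁ same-slot) (proj₂ same-slot)

  totalRoots : List (Run T) → ℕ
  totalRoots rs = sum (map (rootCount ∘ codedRun) rs)

  allSlots : List (Run T) → List (Fin (n + n))
  allSlots rs = concat (map slots rs)

  length-allSlots : ∀ rs → length (allSlots rs) ≡ totalRoots rs
  length-allSlots []       = refl
  length-allSlots (r ∷ rs) = trans (length-++ (slots r)) (cong₂ _+_ (length-tabulate _) (length-allSlots rs))

  totalRoots-≤ : ∀ rs → Unique (map endpoints rs) → totalRoots rs ≤ n + n
  totalRoots-≤ rs unique = subst (_≤ n + n) (length-allSlots rs) (Unique⇒length≤ (concat⁺
    (AllP.map⁺ (All.universal slots-unique rs))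
    (AllPairsP.map⁺ (AllPairs.map (λ {r} {r′} → slots-disjoint r r′) (AllPairsP.map⁻ unique)))))

  exponent-≤ : ∀ r → exponent r ℚ.≤ ℤ.+ (3 * rootCount (codedRun r)) ℚ./ 1
  exponent-≤ r = subst (ℚ._≤ _) (sym (exponent-≡ r))
    (fraction-≤ (length (str r)) (period r ∸ 1) (3 * rootCount (codedRun r)) 0
      (subst (_≤ 3 * rootCount (codedRun r) * suc (period r ∸ 1)) (sym (*-identityʳ _)) (ℓ≤3*rootCount*p (codedRun r))))

  sumExponents-≤ : ∀ rs → sumExponents rs ℚ.≤ ℤ.+ (3 * totalRoots rs) ℚ./ 1
  sumExponents-≤ []       = ℚP.≤-refl
  sumExponents-≤ (r ∷ rs) = ℚP.≤-trans (ℚP.+-mono-≤ (exponent-≤ r) (sumExponents-≤ rs))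
    (ℚP.≤-reflexive (trans (integer-+ (3 * c) (3 * totalRoots rs))
                           (cong (λ k → ℤ.+ k ℚ./ 1) (sym (*-distribˡ-+ 3 c (totalRoots rs))))))
    where
      c : ℕ
      c = rootCount (codedRun r)

  sumExponents-≤-6n : ∀ rs → Unique (map endpoints rs) → sumExponents rs ℚ.≤ ℤ.+ (6 * n) ℚ./ 1
  sumExponents-≤-6n rs unique = ℚP.≤-trans (sumExponents-≤ rs) (fraction-≤ (3 * totalRoots rs) 0 (6 * n) 0 (*-monoˡ-≤ 1 (begin
    3 * totalRoots rs  ≤⟨ *-monoʳ-≤ 3 (totalRoots-≤ rs unique) ⟩
    3 * (n + n)        ≡⟨ solve 1 (λ n → con 3 :* (n :+ n) := con 6 :* n) refl n ⟩
    6 * n              ∎)))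
    where open ≤-Reasoning

mainTheorem2 : ∃[ C ] ((A : Set) (n : ℕ) (T : Trie A n) (rs : List (Run T)) →
                 Unique (map endpoints rs) →
                 sumExponents rs ℚ.≤ (ℤ.+ (C * n)) ℚ./ 1)
-- The bound is decidable, so it may be proved under the double negation that codes the labels.
mainTheorem2 = 6 , λ A n T rs unique →
  decidable-stable (sumExponents rs ℚ.≤? ℤ.+ (6 * n) ℚ./ 1) λ ¬bound →
    ¬¬-faithfulCode (label T) λ (key , faithful) → ¬bound (Codes.sumExponents-≤-6n T key faithful rs unique)
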